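{- Let $G$ be a graph of order $n$, let $I(G)$ be the number of vertices of degree one of $G$, and let $S\in\mathcal{S}(G)$. If there exists a universal vertex $v$ of $G$ such that $v\notin\overline{S}\cup S^*$ for some $S^*\in\mathcal{P}(S)$, then for any graph $H$ of order $n'$, $$\gamma_{\rm sp}(G\Box H)\le n'\gamma_{\rm sp}(G)-I(G)\bigl(n'-\gamma_{\rm sp}(H)\bigr).$$
   Context: All graphs are finite, simple and undirected. For a vertex $v$, $N(v)$ is its set of neighbours; for $D\subseteq V(G)$, $\overline{D}=V(G)\setminus D$. A vertex of a graph of order $n$ is universal if it has $n-1$ neighbours. A set $D\subseteq V(G)$ is a super dominating set of $G$ if for every $u\in\overline{D}$ there exists $v\in D$ such that $N(v)\cap\overline{D}=\{u\}$; the super domination number $\gamma_{\rm sp}(G)$ is the minimum cardinality of a super dominating set, and one of that cardinality is a $\gamma_{\rm sp}(G)$-set. $\mathcal{S}(G)$ is the set of all $\gamma_{\rm sp}(G)$-sets, and for $S\in\mathcal{S}(G)$, $\mathcal{P}(S)$ is the family of subsets $S^*\subseteq S$ with $|S^*|=|\overline{S}|$ such that for every $u\in\overline{S}$ there is $u^*\in S^*$ with $N(u^*)\cap\overline{S}=\{u\}$. The Cartesian product $G\Box H$ has vertex set $V(G)\times V(H)$, with $(g,h)$ adjacent to $(g',h')$ iff either $g=g'$ and $hh'\in E(H)$, or $gg'\in E(G)$ and $h=h'$. -}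

module Defs where

open import Data.Nat using (ℕ; _∸_; _≡ᵇ_)
open import Data.Bool using (Bool; true; false; _∧_; _∨_; not)
open import Data.Bool.Properties using (∧-comm)
open import Data.Fin using (Fin; _≟_; remQuot)
open import Data.Fin.Subset using (Subset; _∈_; _∉_; _⊆_; ∣_∣; ∁)
open import Data.Vec using (tabulate)
open import Data.Product using (Σ; ∃; _×_; _,_; proj₁; proj₂)
open import Relation.Nullary using (¬_; does; yes; no)
open import Relation.Binary.PropositionalEquality using (_≡_; refl; sym; cong₂)
open import Function.Bundles using (_⇔_)

record Graph (n : ℕ) : Set where
  field
    adj    : Fin n → Fin n → Bool
    adj-sym    : ∀ u v → adj u v ≡ adj v u
    adj-irrefl : ∀ v → adj v v ≡ false
open Graph public

N : ∀ {n} → Graph n → Fin n → Subset n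
N G v = tabulate (adj G v)

degree : ∀ {n} → Graph n → Fin n → ℕ
degree G v = ∣ N G v ∣

Universal : ∀ {n} → Graph n → Fin n → Set
Universal {n} G v = degree G v ≡ n ∸ 1

I : ∀ {n} → Graph n → ℕ
I G = ∣ tabulate (λ v → degree G v ≡ᵇ 1) ∣

PrivateTo : ∀ {n} → Graph n → Subset n → Fin n → Fin n → Set
PrivateTo G D v u = ∀ w → ((w ∈ N G v × w ∉ D) ⇔ (w ≡ u))

SuperDominating : ∀ {n} → Graph n → Subset n → Set
SuperDominating G D = ∀ u → u ∉ D → ∃ λ v → v ∈ D × PrivateTo G D v u

IsGammaSpSet : ∀ {n} → Graph n → Subset n → Set
IsGammaSpSet G D = SuperDominating G D × (∀ D′ → SuperDominating G D′ → ∣ D ∣ ≤ℕ ∣ D′ ∣)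
  where open import Data.Nat renaming (_≤_ to _≤ℕ_)

InP : ∀ {n} → Graph n → Subset n → Subset n → Set
InP G S S* = S* ⊆ S × ∣ S* ∣ ≡ ∣ ∁ S ∣
             × (∀ u → u ∉ S → ∃ λ u* → u* ∈ S* × PrivateTo G S u* u)

_==_ : ∀ {n} → Fin n → Fin n → Bool
i == j = does (i ≟ j)

==-sym : ∀ {n} (i j : Fin n) → (i == j) ≡ (j == i)
==-sym i j with i ≟ j | j ≟ i
... | yes _ | yes _ = refl
... | yes p | no q = Data.Empty.⊥-elim (q (sym p)) where import Data.Empty
... | no q | yes p = Data.Empty.⊥-elim (q (sym p)) where import Data.Empty
... | no _ | no _ = refl

==-refl : ∀ {n} (i : Fin n) → (i == i) ≡ true
==-refl i with i ≟ i
... | yes _ = refl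
... | no q = Data.Empty.⊥-elim (q refl) where import Data.Empty

□-adjP : ∀ {n n′} → Graph n → Graph n′ → Fin n × Fin n′ → Fin n × Fin n′ → Bool
□-adjP G H (g , h) (g′ , h′) = ((g == g′) ∧ adj H h h′) ∨ (adj G g g′ ∧ (h == h′))

□-adjP-sym : ∀ {n n′} (G : Graph n) (H : Graph n′) p q → □-adjP G H p q ≡ □-adjP G H q p
□-adjP-sym G H (g , h) (g′ , h′) =
  cong₂ _∨_ (cong₂ _∧_ (==-sym g g′) (adj-sym H h h′))
            (cong₂ _∧_ (adj-sym G g g′) (==-sym h h′))

□-adjP-irrefl : ∀ {n n′} (G : Graph n) (H : Graph n′) p → □-adjP G H p p ≡ false
□-adjP-irrefl G H (g , h) rewrite ==-refl g | ==-refl h | adj-irrefl H h | adj-irrefl G g = refl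

-- The Cartesian product G □ H, with the vertex (g,h) ∈ Fin n × Fin n′
-- encoded as an element of Fin (n * n′) via the bijection remQuot / combine
_□_ : ∀ {n n′} → Graph n → Graph n′ → Graph (n Data.Nat.* n′)
_□_ {n} {n′} G H = record
  { adj = λ x y → □-adjP G H (remQuot n′ x) (remQuot n′ y)
  ; adj-sym = λ x y → □-adjP-sym G H (remQuot n′ x) (remQuot n′ y)
  ; adj-irrefl = λ x → □-adjP-irrefl G H (remQuot n′ x) }

module Submission where

-- With L the set of leaves of G, D′ = (S ∖ L) × V(H) ∪ (L × T) is a super dominating set of
-- G □ H of size n′|S| − |L|(n′ − |T|).  Everything rests on the universal vertex v ∈ S ∖ S*:
-- a leaf other than v hangs on v, so leaves lie in S, their neighbours lie in S, and no leaf is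
-- a private neighbour u* ∈ S* or adjacent to one.  Hence a vertex (g, h) ∉ D′ is privately
-- dominated by (u*, h) when g ∉ S has private neighbour u*, and by (g, t) when g is a leaf and
-- h ∉ T has private neighbour t ∈ T.

open import Defs
open import Data.Nat as ℕ using (ℕ; zero; suc; _+_; _*_; _∸_; _≤_)
open import Data.Nat.Properties
  using (+-assoc; +-identityʳ; *-identityˡ; *-identityʳ; *-zeroʳ; <-irrefl; m+[n∸m]≡n; +-monoˡ-≤;
         +-*-semiring; module ≤-Reasoning)
open import Data.Bool using (Bool; true; false)
open import Data.Bool.Properties using (∨-zeroʳ)
open import Data.Fin using (Fin; zero; suc; _≟_; _↑ˡ_; _↑ʳ_; combine; remQuot)
open import Data.Fin.Properties using (remQuot-combine; combine-remQuot)
open import Data.Fin.Subset using (Subset; _∈_; _∉_; _⊆_; _⊂_; ∣_∣; _∪_; ∁; ⁅_⁆)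
open import Data.Fin.Subset.Properties
  using (_∈?_; ∣p∣≤n; p⊂q⇒∣p∣<∣q∣; ∣∁p∣≡n∸∣p∣; ∣⁅x⁆∣≡1; x∈⁅y⁆⇒x≡y; x≢y⇒x∉⁅y⁆;
         x∉p⇒x∈∁p; x∉∁p⇒x∈p; p⊆p∪q; q⊆p∪q)
open import Data.Vec using ([]; _∷_; tabulate)
open import Data.Vec.Properties using (lookup∘tabulate; []=⇒lookup; lookup⇒[]=)
open import Data.Product using (∃; _×_; _,_; proj₁; proj₂; uncurry)
open import Data.Sum using (_⊎_; inj₁; inj₂)
open import Function using (_∘_; _⇔_; mk⇔; Equivalence)
open import Relation.Nullary using (¬_; does; yes; no; contradiction)
open import Relation.Nullary.Decidable using (Dec; dec-true; dec-false)
open import Relation.Binary.PropositionalEquality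
  using (_≡_; _≢_; refl; sym; trans; cong; cong₂; subst; module ≡-Reasoning)
open import Algebra.Properties.Semiring.Sum +-*-semiring
  using (sum; sum-syntax; sum-cong-≗; sum-replicate-zero; ∑-distrib-+; *-distribˡ-sum; *-distribʳ-sum)

open Equivalence using (to; from)

≡true⇒≢false : ∀ {b} → b ≡ true → b ≢ false
≡true⇒≢false refl ()

𝟙 : Bool → ℕ
𝟙 true  = 1
𝟙 false = 0

∣tabulate∣≡∑ : ∀ {m} (f : Fin m → Bool) → ∣ tabulate f ∣ ≡ ∑[ i < m ] 𝟙 (f i)
∣tabulate∣≡∑ {zero}  f = refl
∣tabulate∣≡∑ {suc m} f with f zero
... | true  = cong suc (∣tabulate∣≡∑ (f ∘ suc))
... | false = ∣tabulate∣≡∑ (f ∘ suc)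

∣p∣≡∑∈? : ∀ {m} (p : Subset m) → ∣ p ∣ ≡ ∑[ i < m ] 𝟙 (does (i ∈? p))
∣p∣≡∑∈? []          = refl
∣p∣≡∑∈? (true  ∷ p) = cong suc (∣p∣≡∑∈? p)
∣p∣≡∑∈? (false ∷ p) = ∣p∣≡∑∈? p

∑1≡n : ∀ n → ∑[ i < n ] 1 ≡ n
∑1≡n zero    = refl
∑1≡n (suc n) = cong suc (∑1≡n n)

sum-↑ : ∀ k {l} (f : Fin (k + l) → ℕ) → sum f ≡ ∑[ i < k ] f (i ↑ˡ l) + ∑[ j < l ] f (k ↑ʳ j)
sum-↑ zero    f = refl
sum-↑ (suc k) f = trans (cong (f zero +_) (sum-↑ k (f ∘ suc))) (sym (+-assoc (f zero) _ _))

sum-combine : ∀ m k (f : Fin (m * k) → ℕ) → sum f ≡ ∑[ i < m ] ∑[ j < k ] f (combine i j)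
sum-combine zero    k f = refl
sum-combine (suc m) k f =
  trans (sum-↑ k f) (cong (∑[ j < k ] f (j ↑ˡ (m * k)) +_) (sum-combine m k (f ∘ (k ↑ʳ_))))

∣tabulate∘remQuot∣ : ∀ m k (P : Fin m × Fin k → Bool) →
                     ∣ tabulate (P ∘ remQuot k) ∣ ≡ ∑[ i < m ] ∑[ j < k ] 𝟙 (P (i , j))
∣tabulate∘remQuot∣ m k P = begin
  ∣ tabulate (P ∘ remQuot k) ∣                               ≡⟨ ∣tabulate∣≡∑ (P ∘ remQuot k) ⟩
  ∑[ x < m * k ] 𝟙 (P (remQuot k x))                         ≡⟨ sum-combine m k (𝟙 ∘ P ∘ remQuot k) ⟩
  ∑[ i < m ] ∑[ j < k ] 𝟙 (P (remQuot k (combine i j)))      ≡⟨ sum-cong-≗ (λ i → sum-cong-≗ (λ j →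
                                                                  cong (𝟙 ∘ P) (remQuot-combine i j))) ⟩
  ∑[ i < m ] ∑[ j < k ] 𝟙 (P (i , j))                        ∎
  where open ≡-Reasoning

∈tabulate⇔ : ∀ {m} {f : Fin m → Bool} {x} → x ∈ tabulate f ⇔ f x ≡ true
∈tabulate⇔ {f = f} {x} = mk⇔
  (λ x∈ → trans (sym (lookup∘tabulate f x)) ([]=⇒lookup x∈))
  (λ fx → lookup⇒[]= x (tabulate f) (trans (lookup∘tabulate f x) fx))

∉tabulate⇒≡false : ∀ {m} {f : Fin m → Bool} {x} → x ∉ tabulate f → f x ≡ false
∉tabulate⇒≡false {f = f} {x} x∉ with f x in fx
... | true  = contradiction (from ∈tabulate⇔ fx) x∉
... | false = refl

module _ {n} (G : Graph n) where

  Leaf : Fin n → Set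
  Leaf ℓ = degree G ℓ ≡ 1

  leaf? : ∀ ℓ → Dec (Leaf ℓ)
  leaf? ℓ = degree G ℓ ℕ.≟ 1

  ∈N⇔adj : ∀ {v w} → w ∈ N G v ⇔ adj G v w ≡ true
  ∈N⇔adj = ∈tabulate⇔

  N-sym : ∀ {v w} → w ∈ N G v → v ∈ N G w
  N-sym {v} {w} w∈ = from ∈N⇔adj (trans (adj-sym G w v) (to ∈N⇔adj w∈))

  N-irrefl : ∀ {v} → v ∉ N G v
  N-irrefl {v} v∈ with () ← trans (sym (adj-irrefl G v)) (to ∈N⇔adj v∈)

  universal⇒∈N : ∀ {v w} → Universal G v → w ≢ v → w ∈ N G v
  universal⇒∈N {v} {w} v-universal w≢v with w ∈? N G v
  ... | yes w∈ = w∈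
  ... | no  w∉ = contradiction (p⊂q⇒∣p∣<∣q∣ N⊂∁⁅v⁆) (<-irrefl ∣N∣≡∣∁⁅v⁆∣)
    where
    N⊂∁⁅v⁆ : N G v ⊂ ∁ ⁅ v ⁆
    N⊂∁⁅v⁆ = (λ {x} x∈ → x∉p⇒x∈∁p (x≢y⇒x∉⁅y⁆ λ { refl → N-irrefl x∈ }))
           , w , x∉p⇒x∈∁p (x≢y⇒x∉⁅y⁆ w≢v) , w∉

    ∣N∣≡∣∁⁅v⁆∣ : degree G v ≡ ∣ ∁ ⁅ v ⁆ ∣
    ∣N∣≡∣∁⁅v⁆∣ = trans v-universal (sym (trans (∣∁p∣≡n∸∣p∣ ⁅ v ⁆) (cong (n ∸_) (∣⁅x⁆∣≡1 v))))

  leaf-neighbour-unique : ∀ {ℓ a b} → Leaf ℓ → a ∈ N G ℓ → b ∈ N G ℓ → a ≡ b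
  leaf-neighbour-unique {ℓ} {a} {b} leaf a∈ b∈ with a ≟ b
  ... | yes a≡b = a≡b
  ... | no  a≢b = contradiction (p⊂q⇒∣p∣<∣q∣ ⁅a⁆⊂N) (<-irrefl (trans (∣⁅x⁆∣≡1 a) (sym leaf)))
    where
    ⁅a⁆⊂N : ⁅ a ⁆ ⊂ N G ℓ
    ⁅a⁆⊂N = (λ x∈ → subst (_∈ N G ℓ) (sym (x∈⁅y⁆⇒x≡y a x∈)) a∈) , b , b∈ , x≢y⇒x∉⁅y⁆ (a≢b ∘ sym)

module _ {n} (G : Graph n) {D : Subset n} {v u : Fin n} (v-private : PrivateTo G D v u) where

  PrivateTo⇒∈N : u ∈ N G v
  PrivateTo⇒∈N = proj₁ (from (v-private u) refl)

  PrivateTo⇒unique : ∀ {w} → w ∈ N G v → w ∉ D → w ≡ u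
  PrivateTo⇒unique w∈ w∉ = to (v-private _) (w∈ , w∉)

module _ {n n′} (G : Graph n) (H : Graph n′) where

  data □-Edge : Fin n × Fin n′ → Fin n × Fin n′ → Set where
    vertical   : ∀ {g h h′} → h′ ∈ N H h → □-Edge (g , h) (g , h′)
    horizontal : ∀ {g g′ h} → g′ ∈ N G g → □-Edge (g , h) (g′ , h)

  □-Edge⇒adjP : ∀ {p q} → □-Edge p q → □-adjP G H p q ≡ true
  □-Edge⇒adjP (vertical {g} h′∈) rewrite ==-refl g | to (∈N⇔adj H) h′∈ = refl
  □-Edge⇒adjP (horizontal {h = h} g′∈) rewrite ==-refl h | to (∈N⇔adj G) g′∈ = ∨-zeroʳ _

  adjP⇒□-Edge : ∀ p q → □-adjP G H p q ≡ true → □-Edge p q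
  adjP⇒□-Edge (g , h) (g′ , h′) e with g ≟ g′ | adj H h h′ in hh′ | adj G g g′ in gg′ | h ≟ h′
  ... | yes refl | true | _    | _        = vertical (from (∈N⇔adj H) hh′)
  ... | _        | _    | true | yes refl = horizontal (from (∈N⇔adj G) gg′)

  module _ (P : Fin n × Fin n′ → Bool) where

    PrivateEdge : Fin n × Fin n′ → Fin n × Fin n′ → Set
    PrivateEdge a b = P a ≡ true × □-Edge a b × (∀ q → □-Edge a q → P q ≡ false → q ≡ b)

    superDominating-□ : (∀ b → P b ≡ false → ∃ λ a → PrivateEdge a b) →
                        SuperDominating (G □ H) (tabulate (P ∘ remQuot n′))
    superDominating-□ private-edge x x∉ with private-edge (remQuot n′ x) (∉tabulate⇒≡false x∉)
    ... | a , Pa , a—x , unique =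
      combine′ a , from ∈tabulate⇔ P[a] , λ w → mk⇔ (only-x w) (λ { refl → edge⇒∈N a—x , x∉ })
      where
      combine′ : Fin n × Fin n′ → Fin (n * n′)
      combine′ = uncurry combine

      remQuot∘combine′ : ∀ p → remQuot n′ (combine′ p) ≡ p
      remQuot∘combine′ (i , j) = remQuot-combine i j

      P[a] : P (remQuot n′ (combine′ a)) ≡ true
      P[a] = trans (cong P (remQuot∘combine′ a)) Pa

      edge⇒∈N : ∀ {w} → □-Edge a (remQuot n′ w) → w ∈ N (G □ H) (combine′ a)
      edge⇒∈N e = from ∈tabulate⇔
        (subst (λ p → □-adjP G H p _ ≡ true) (sym (remQuot∘combine′ a)) (□-Edge⇒adjP e))

      only-x : ∀ w → w ∈ N (G □ H) (combine′ a) × w ∉ tabulate (P ∘ remQuot n′) → w ≡ x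
      only-x w (w∈ , w∉) = begin
        w                          ≡⟨ combine-remQuot {n} n′ w ⟨
        combine′ (remQuot n′ w)    ≡⟨ cong combine′ (unique _ a—w (∉tabulate⇒≡false w∉)) ⟩
        combine′ (remQuot n′ x)    ≡⟨ combine-remQuot {n} n′ x ⟩
        x                          ∎
        where
        open ≡-Reasoning
        a—w : □-Edge a (remQuot n′ w)
        a—w = adjP⇒□-Edge a _
          (subst (λ p → □-adjP G H p _ ≡ true) (remQuot∘combine′ a) (to ∈tabulate⇔ w∈))

module Construction
  {n} (G : Graph n) (S : Subset n) (v : Fin n) (v-universal : Universal G v)
  (S* : Subset n) (S*∈𝒫 : InP G S S*) (v∉ : v ∉ ∁ S ∪ S*)
  {n′} (H : Graph n′) (T : Subset n′) (T-superDominating : SuperDominating H T) where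

  v∈S : v ∈ S
  v∈S = x∉∁p⇒x∈p (v∉ ∘ p⊆p∪q S*)

  v∉S* : v ∉ S*
  v∉S* = v∉ ∘ q⊆p∪q (∁ S) S*

  ∉S⇒≢v : ∀ {u} → u ∉ S → u ≢ v
  ∉S⇒≢v u∉ refl = u∉ v∈S

  ∈S*⇒≢v : ∀ {u} → u ∈ S* → u ≢ v
  ∈S*⇒≢v u∈ refl = v∉S* u∈

  v-adjacent : ∀ {w} → w ≢ v → w ∈ N G v
  v-adjacent = universal⇒∈N G v-universal

  S*⊆S : S* ⊆ S
  S*⊆S = proj₁ S*∈𝒫

  private-neighbour : ∀ {u} → u ∉ S → ∃ λ u* → u* ∈ S* × PrivateTo G S u* u
  private-neighbour = proj₂ (proj₂ S*∈𝒫) _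

  leaf-neighbour≡v : ∀ {ℓ w} → Leaf G ℓ → ℓ ≢ v → w ∈ N G ℓ → w ≡ v
  leaf-neighbour≡v leaf ℓ≢v w∈ = leaf-neighbour-unique G leaf w∈ (N-sym G (v-adjacent ℓ≢v))

  leaf⇒∈S : ∀ {ℓ} → Leaf G ℓ → ℓ ∈ S
  leaf⇒∈S {ℓ} leaf with ℓ ∈? S
  ... | yes ℓ∈S = ℓ∈S
  ... | no  ℓ∉S with u* , u*∈S* , u*-private ← private-neighbour ℓ∉S =
    contradiction (leaf-neighbour≡v leaf (∉S⇒≢v ℓ∉S) (N-sym G (PrivateTo⇒∈N G u*-private))) (∈S*⇒≢v u*∈S*)

  leaf-neighbour⇒∈S : ∀ {ℓ w} → Leaf G ℓ → w ∈ N G ℓ → w ∈ S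
  leaf-neighbour⇒∈S {ℓ} {w} leaf w∈ with w ∈? S | ℓ ≟ v
  ... | yes w∈S | _        = w∈S
  ... | no  w∉S | no  ℓ≢v  = contradiction (leaf-neighbour≡v leaf ℓ≢v w∈) (∉S⇒≢v w∉S)
  ... | no  w∉S | yes refl with u* , u*∈S* , _ ← private-neighbour w∉S =
    contradiction (subst (_∈ S) (leaf-neighbour-unique G leaf (v-adjacent (∈S*⇒≢v u*∈S*)) w∈)
                         (S*⊆S u*∈S*)) w∉S

  private-neighbour-¬leaf : ∀ {u u*} → u ∉ S → PrivateTo G S u* u → ¬ Leaf G u*
  private-neighbour-¬leaf u∉S u*-private leaf = u∉S (leaf-neighbour⇒∈S leaf (PrivateTo⇒∈N G u*-private))

  leaf-¬adjacent-private-neighbour : ∀ {u u* ℓ} → u ∉ S → u* ∈ S* → PrivateTo G S u* u →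
                                     Leaf G ℓ → u* ∉ N G ℓ
  leaf-¬adjacent-private-neighbour {u} {u*} {ℓ} u∉S u*∈S* u*-private leaf u*∈ with ℓ ≟ v
  ... | no  ℓ≢v  = ∈S*⇒≢v u*∈S* (leaf-neighbour≡v leaf ℓ≢v u*∈)
  ... | yes refl = u∉S (subst (_∈ S) (leaf-neighbour-unique G leaf u*∈ (v-adjacent (∉S⇒≢v u∉S)))
                                (S*⊆S u*∈S*))

  inD′ : Fin n × Fin n′ → Bool
  inD′ (g , h) with g ∈? S | leaf? G g
  ... | no  _ | _     = false
  ... | yes _ | no  _ = true
  ... | yes _ | yes _ = does (h ∈? T)

  D′ : Subset (n * n′)
  D′ = tabulate (inD′ ∘ remQuot n′)

  row-count : ∀ g → ∑[ h < n′ ] 𝟙 (inD′ (g , h)) + 𝟙 (does (leaf? G g)) * (n′ ∸ ∣ T ∣)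
                    ≡ n′ * 𝟙 (does (g ∈? S))
  row-count g with g ∈? S | leaf? G g
  ... | no  g∉S | yes leaf = contradiction (leaf⇒∈S leaf) g∉S
  ... | no  _   | no  ¬leaf rewrite dec-false (leaf? G g) ¬leaf =
    trans (+-identityʳ _) (trans (sum-replicate-zero n′) (sym (*-zeroʳ n′)))
  ... | yes _   | no  ¬leaf rewrite dec-false (leaf? G g) ¬leaf =
    trans (+-identityʳ _) (trans (∑1≡n n′) (sym (*-identityʳ n′)))
  ... | yes _   | yes leaf  rewrite dec-true (leaf? G g) leaf = begin
    ∑[ h < n′ ] 𝟙 (does (h ∈? T)) + 1 * (n′ ∸ ∣ T ∣)  ≡⟨ cong₂ _+_ (sym (∣p∣≡∑∈? T)) (*-identityˡ _) ⟩
    ∣ T ∣ + (n′ ∸ ∣ T ∣)                              ≡⟨ m+[n∸m]≡n (∣p∣≤n T) ⟩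
    n′                                                ≡⟨ *-identityʳ n′ ⟨
    n′ * 1                                            ∎
    where open ≡-Reasoning

  ∣D′∣+I[G]*[n′∸∣T∣]≡n′*∣S∣ : ∣ D′ ∣ + I G * (n′ ∸ ∣ T ∣) ≡ n′ * ∣ S ∣
  ∣D′∣+I[G]*[n′∸∣T∣]≡n′*∣S∣ = begin
    ∣ D′ ∣ + I G * k                                      ≡⟨ cong₂ (λ d i → d + i * k) (∣tabulate∘remQuot∣ n n′ inD′)
                                                                                    (∣tabulate∣≡∑ leafᵇ) ⟩
    ∑[ g < n ] row g + ∑[ g < n ] 𝟙 (leafᵇ g) * k         ≡⟨ cong (∑[ g < n ] row g +_) (*-distribʳ-sum k (𝟙 ∘ leafᵇ)) ⟩
    ∑[ g < n ] row g + ∑[ g < n ] (𝟙 (leafᵇ g) * k)       ≡⟨ ∑-distrib-+ row (λ g → 𝟙 (leafᵇ g) * k) ⟨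
    ∑[ g < n ] (row g + 𝟙 (leafᵇ g) * k)                  ≡⟨ sum-cong-≗ row-count ⟩
    ∑[ g < n ] (n′ * 𝟙 (does (g ∈? S)))                   ≡⟨ *-distribˡ-sum n′ (λ g → 𝟙 (does (g ∈? S))) ⟨
    n′ * ∑[ g < n ] 𝟙 (does (g ∈? S))                     ≡⟨ cong (n′ *_) (∣p∣≡∑∈? S) ⟨
    n′ * ∣ S ∣                                            ∎
    where
    open ≡-Reasoning
    k = n′ ∸ ∣ T ∣
    -- I G counts the vertices with degree G g ≡ᵇ 1, which is definitionally leafᵇ g.
    leafᵇ : Fin n → Bool
    leafᵇ g = does (leaf? G g)
    row : Fin n → ℕ
    row g = ∑[ h < n′ ] 𝟙 (inD′ (g , h))

  ∈S×¬Leaf⇒inD′ : ∀ {g h} → g ∈ S → ¬ Leaf G g → inD′ (g , h) ≡ true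
  ∈S×¬Leaf⇒inD′ {g} g∈S ¬leaf with g ∈? S | leaf? G g
  ... | no  g∉S | _        = contradiction g∈S g∉S
  ... | yes _   | no  _    = refl
  ... | yes _   | yes leaf = contradiction leaf ¬leaf

  ∈S×∈T⇒inD′ : ∀ {g h} → g ∈ S → h ∈ T → inD′ (g , h) ≡ true
  ∈S×∈T⇒inD′ {g} {h} g∈S h∈T with g ∈? S | leaf? G g
  ... | no  g∉S | _     = contradiction g∈S g∉S
  ... | yes _   | no  _ = refl
  ... | yes _   | yes _ = dec-true (h ∈? T) h∈T

  inD′≡false⇒ : ∀ {g h} → inD′ (g , h) ≡ false → g ∉ S ⊎ (Leaf G g × h ∉ T)
  inD′≡false⇒ {g} {h} e with g ∈? S | leaf? G g
  ... | no  g∉S | _        = inj₁ g∉S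
  ... | yes _   | yes leaf = inj₂ (leaf , λ h∈T → ≡true⇒≢false (dec-true (h ∈? T) h∈T) e)

  private-outside-S : ∀ {g h} → g ∉ S → ∃ λ a → PrivateEdge G H inD′ a (g , h)
  private-outside-S {g} {h} g∉S with u* , u*∈S* , u*-private ← private-neighbour g∉S =
    (u* , h) , u*∈D′ , horizontal (PrivateTo⇒∈N G u*-private) , unique
    where
    u*∈D′ : ∀ {h′} → inD′ (u* , h′) ≡ true
    u*∈D′ = ∈S×¬Leaf⇒inD′ (S*⊆S u*∈S*) (private-neighbour-¬leaf g∉S u*-private)

    unique : ∀ q → □-Edge G H (u* , h) q → inD′ q ≡ false → q ≡ (g , h)
    unique _ (vertical _) q∉ = contradiction q∉ (≡true⇒≢false u*∈D′)
    unique _ (horizontal g′∈) q∉ with inD′≡false⇒ q∉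
    ... | inj₁ g′∉S       = cong (_, h) (PrivateTo⇒unique G u*-private g′∈ g′∉S)
    ... | inj₂ (leaf , _) =
      contradiction (N-sym G g′∈) (leaf-¬adjacent-private-neighbour g∉S u*∈S* u*-private leaf)

  private-leaf-row : ∀ {g h} → Leaf G g → h ∉ T → ∃ λ a → PrivateEdge G H inD′ a (g , h)
  private-leaf-row {g} {h} leaf h∉T with t , t∈T , t-private ← T-superDominating h h∉T =
    (g , t) , ∈S×∈T⇒inD′ g∈S t∈T , vertical (PrivateTo⇒∈N H t-private) , unique
    where
    g∈S : g ∈ S
    g∈S = leaf⇒∈S leaf

    unique : ∀ q → □-Edge G H (g , t) q → inD′ q ≡ false → q ≡ (g , h)
    unique _ (vertical h′∈) q∉ with inD′≡false⇒ q∉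
    ... | inj₁ g∉S        = contradiction g∈S g∉S
    ... | inj₂ (_ , h′∉T) = cong (g ,_) (PrivateTo⇒unique H t-private h′∈ h′∉T)
    unique _ (horizontal g′∈) q∉ =
      contradiction q∉ (≡true⇒≢false (∈S×∈T⇒inD′ (leaf-neighbour⇒∈S leaf g′∈) t∈T))

  D′-superDominating : SuperDominating (G □ H) D′
  D′-superDominating = superDominating-□ G H inD′ private-edge
    where
    private-edge : ∀ b → inD′ b ≡ false → ∃ λ a → PrivateEdge G H inD′ a b
    private-edge (g , h) b∉ with inD′≡false⇒ b∉
    ... | inj₁ g∉S          = private-outside-S g∉S
    ... | inj₂ (leaf , h∉T) = private-leaf-row leaf h∉T

proposition28 : ∀ {n} (G : Graph n) (S : Subset n) → IsGammaSpSet G S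
    → (∃ λ v → Universal G v × (∃ λ S* → InP G S S* × v ∉ (∁ S ∪ S*)))
    → ∀ {n′} (H : Graph n′) (T : Subset n′) → IsGammaSpSet H T
    → (D : Subset (n * n′)) → IsGammaSpSet (G □ H) D
    → ∣ D ∣ + I G * (n′ ∸ ∣ T ∣) ≤ n′ * ∣ S ∣
proposition28 G S _ (v , v-universal , S* , S*∈𝒫 , v∉) {n′} H T (T-superDominating , _) D (_ , D-minimum) =
  begin
    ∣ D ∣ + I G * (n′ ∸ ∣ T ∣)   ≤⟨ +-monoˡ-≤ _ (D-minimum D′ D′-superDominating) ⟩
    ∣ D′ ∣ + I G * (n′ ∸ ∣ T ∣)  ≡⟨ ∣D′∣+I[G]*[n′∸∣T∣]≡n′*∣S∣ ⟩
    n′ * ∣ S ∣                   ∎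
  where
  open ≤-Reasoning
  open Construction G S v v-universal S* S*∈𝒫 v∉ H T T-superDominating
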